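{- Let $r,s\in\mathbb{N}$ with $r<s$ and let $\mathcal{A}=\{r,s\}$. Let $z\in\mathcal{A}^{\mathbb{N}}$ be a Kolakoski sequence over $\mathcal{A}$. Then: (1) $z$ is not eventually periodic, i.e., there do not exist $m,q\in\mathbb{N}$ such that $z_{i+1}\ldots z_{i+q}=z_{i+q+1}\ldots z_{i+2q}$ for all $i\ge m$. (2) If $z$ is mirror invariant, then $z$ is recurrent, i.e., every word that occurs in $z$ occurs in $z$ infinitely often. (3) $z$ is mirror invariant if and only if every $C^{\infty}$-word over $\mathcal{A}$ occurs in $z$.
   Context: A run in a (finite or infinite) word is a maximal subword consisting of identical letters. A one-sided infinite sequence $z\in\{r,s\}^{\mathbb{N}}$ is a Kolakoski sequence over $\{r,s\}$ if the sequence of lengths of its consecutive runs equals $z$ itself. For a word $w=w_1\ldots w_n$, $\tilde{w}=\tilde{w}_1\ldots\tilde{w}_n$ where $\tilde{r}=s$, $\tilde{s}=r$. A sequence $z$ is mirror invariant if for every word $w$: $w$ occurs in $z$ iff $\tilde{w}$ occurs in $z$. Derivative: for a word $w$ over $\{r,s\}$ (with $r<s$), $D(w)$ is defined as follows. $D(\varepsilon)=\varepsilon$ ($\varepsilon$ the empty word). If $w$ is a single run of length less than $s$, then $D(w)=\varepsilon$. Otherwise, alter $w$ as follows: if the first (respectively last) run of $w$ has length at most $r$, delete it; if it has length between $r+1$ and $s$, extend it to a run of length exactly $s$; then $D(w)$ is the sequence of run lengths of the altered word (possibly empty). A word $w$ is differentiable if $D(w)$ is again a word over $\{r,s\}$ (possibly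 empty), and $w$ is a $C^{\infty}$-word if $D^k(w)$ is a word over $\{r,s\}$ for every $k\ge 0$. (Example over $\{2,5\}$: $D(255555222)=55$, $D(2222)=\varepsilon$, $D(25555552)=6$ is not over the alphabet.) -}

module Defs where

open import Data.Nat using (ℕ; zero; suc; _+_; _≤_; _<_; _≤ᵇ_; _<ᵇ_; _≡ᵇ_)
open import Data.Bool using (if_then_else_)
open import Data.List using (List; []; _∷_; _++_; map)
open import Data.List.Relation.Unary.All using (All)
open import Data.Product using (_×_; _,_; proj₂; ∃)
open import Data.Sum using (_⊎_)
open import Data.Unit using (⊤)
open import Relation.Binary.PropositionalEquality using (_≡_; _≢_)

-- Sequences z ∈ A^ℕ are functions ℕ → ℕ, 0-indexed (z 0 is the paper's z_1).
-- Words are lists of natural numbers.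

OverAlphabet : ℕ → ℕ → List ℕ → Set
OverAlphabet r s w = All (λ a → a ≡ r ⊎ a ≡ s) w

SeqOverAlphabet : ℕ → ℕ → (ℕ → ℕ) → Set
SeqOverAlphabet r s z = ∀ i → z i ≡ r ⊎ z i ≡ s

pos : (ℕ → ℕ) → ℕ → ℕ
pos z zero = zero
pos z (suc k) = pos z k + z k

-- z is Kolakoski: its maximal runs are exactly the consecutive blocks
-- [pos z k, pos z (k+1)) of lengths z k, i.e. z is constant on each block and
-- consecutive blocks carry different letters (so these blocks are the maximal runs),
-- hence the sequence of run lengths is z itself.
Kolakoski : (ℕ → ℕ) → Set
Kolakoski z = ∀ k →
  (∀ i → pos z k ≤ i → i < pos z (suc k) → z i ≡ z (pos z k))
  × z (pos z (suc k)) ≢ z (pos z k)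

OccursAt : (ℕ → ℕ) → List ℕ → ℕ → Set
OccursAt z [] i = ⊤
OccursAt z (a ∷ w) i = z i ≡ a × OccursAt z w (suc i)

Occurs : (ℕ → ℕ) → List ℕ → Set
Occurs z w = ∃ λ i → OccursAt z w i

Recurrent : (ℕ → ℕ) → Set
Recurrent z = ∀ w → Occurs z w → ∀ n → ∃ λ i → n ≤ i × OccursAt z w i

-- eventually periodic with period q ≥ 1 from index m on:
-- z_{i+1}..z_{i+q} = z_{i+q+1}..z_{i+2q} for all i ≥ m (shifted to 0-indexing)
EventuallyPeriodic : (ℕ → ℕ) → Set
EventuallyPeriodic z = ∃ λ m → ∃ λ q → 1 ≤ q ×
  (∀ i → m ≤ i → ∀ j → j < q → z (i + j) ≡ z (i + q + j))

-- the letter exchange r ↔ s (only applied to letters in {r,s})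
mirror : ℕ → ℕ → ℕ → ℕ
mirror r s a = if a ≡ᵇ r then s else r

MirrorInvariant : ℕ → ℕ → (ℕ → ℕ) → Set
MirrorInvariant r s z = ∀ w → OverAlphabet r s w →
  (Occurs z w → Occurs z (map (mirror r s) w)) × (Occurs z (map (mirror r s) w) → Occurs z w)

-- run decomposition: list of (letter , run length)
push : ℕ → List (ℕ × ℕ) → List (ℕ × ℕ)
push a [] = (a , 1) ∷ []
push a ((b , n) ∷ t) = if a ≡ᵇ b then (b , suc n) ∷ t else (a , 1) ∷ (b , n) ∷ t

runs : List ℕ → List (ℕ × ℕ)
runs [] = []
runs (a ∷ w) = push a (runs w)

runLengths : List ℕ → List ℕ
runLengths w = map proj₂ (runs w)

adj : ℕ → ℕ → ℕ → List ℕ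
adj r s ℓ = if ℓ ≤ᵇ r then [] else (if ℓ ≤ᵇ s then s ∷ [] else ℓ ∷ [])

adjLast : ℕ → ℕ → List ℕ → List ℕ
adjLast r s [] = []
adjLast r s (x ∷ []) = adj r s x
adjLast r s (x ∷ y ∷ t) = x ∷ adjLast r s (y ∷ t)

Dlens : ℕ → ℕ → List ℕ → List ℕ
Dlens r s [] = []
Dlens r s (ℓ ∷ []) = if ℓ <ᵇ s then [] else adj r s ℓ
Dlens r s (ℓ ∷ m ∷ t) = adj r s ℓ ++ adjLast r s (m ∷ t)

D : ℕ → ℕ → List ℕ → List ℕ
D r s w = Dlens r s (runLengths w)

Diter : ℕ → ℕ → ℕ → List ℕ → List ℕ
Diter r s zero w = w
Diter r s (suc k) w = D r s (Diter r s k w)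

CInfinity : ℕ → ℕ → List ℕ → Set
CInfinity r s w = ∀ k → OverAlphabet r s (Diter r s k w)

module Submission where

-- A period q from m on shifts
-- block boundaries onto block boundaries, so the block lengths themselves are
-- periodic with a period t ≤ q; t = q would force all blocks to have length 1,
-- which is impossible, so t < q and infinite descent on q gives a contradiction.
--
-- (3, ⇐) follows from two facts: the derivative of a factor of z is again a
-- factor (a factor is cut out of consecutive blocks, and D reads off their
-- lengths), so every factor is C∞; and the mirror image of a C∞-word is C∞
-- (mirroring does not change run lengths).
--
-- (3, ⇒) and (2) come from one induction on the length of a C∞-word w: D(w) is
-- shorter, so by induction it occurs beyond any bound; lifting that occurrence
-- of D(w) back through the block structure yields, far out, an occurrence of
-- w or of its mirror image, and mirror invariance turns the latter into a later
-- occurrence of w.  Recurrence is this statement applied to factors, which are C∞.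

open import Defs
open import Data.Nat using (ℕ; zero; suc; _+_; _≤_; _<_; _≤ᵇ_; _<ᵇ_; _≡ᵇ_; z≤n; s≤s; s≤s⁻¹; _≟_; _≤?_; _<?_)
open import Data.Nat.Properties
open import Algebra.Properties.CommutativeSemigroup +-commutativeSemigroup using (xy∙z≈xz∙y)
open import Data.Bool using (Bool; true; false; T)
open import Data.List using (List; []; _∷_; _++_; map; length; replicate)
open import Data.Nat.ListAction using (sum)
open import Data.Nat.ListAction.Properties using (sum-++)
open import Data.List.Properties using (length-++; map-++; ++-identityʳ; length-map; length-replicate; map-replicate)
open import Data.List.Relation.Unary.All using (All; []; _∷_)
import Data.List.Relation.Unary.All.Properties as AllP
open import Data.Product using (_×_; _,_; proj₁; proj₂; ∃)
open import Data.Sum using (_⊎_; inj₁; inj₂)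
open import Data.Unit using (tt)
open import Data.Empty using (⊥-elim)
open import Function using (_∘_)
open import Relation.Nullary using (¬_; yes; no)
open import Relation.Binary.PropositionalEquality
open import Relation.Binary.Definitions using (tri<; tri≈; tri>)

≡⇒≡ᵇ-true : ∀ m n → m ≡ n → (m ≡ᵇ n) ≡ true
≡⇒≡ᵇ-true zero zero refl = refl
≡⇒≡ᵇ-true (suc m) (suc n) refl = ≡⇒≡ᵇ-true m n refl

≡ᵇ-true⇒≡ : ∀ m n → (m ≡ᵇ n) ≡ true → m ≡ n
≡ᵇ-true⇒≡ m n e = ≡ᵇ⇒≡ m n (subst T (sym e) tt)

≢⇒≡ᵇ-false : ∀ m n → m ≢ n → (m ≡ᵇ n) ≡ false
≢⇒≡ᵇ-false m n m≢n with m ≡ᵇ n in e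
... | true = ⊥-elim (m≢n (≡ᵇ-true⇒≡ m n e))
... | false = refl

window : (ℕ → ℕ) → ℕ → ℕ → List ℕ
window z p zero = []
window z p (suc L) = z p ∷ window z (suc p) L

length-window : ∀ z p L → length (window z p L) ≡ L
length-window z p zero = refl
length-window z p (suc L) = cong suc (length-window z (suc p) L)

occursAt⇒window : ∀ z w p → OccursAt z w p → window z p (length w) ≡ w
occursAt⇒window z [] p tt = refl
occursAt⇒window z (a ∷ w) p (e , o) = cong₂ _∷_ e (occursAt⇒window z w (suc p) o)

window-occursAt : ∀ z p L → OccursAt z (window z p L) p
window-occursAt z p zero = tt
window-occursAt z p (suc L) = refl , window-occursAt z (suc p) L

window⇒occursAt : ∀ z {w} p L → window z p L ≡ w → OccursAt z w p
window⇒occursAt z p L refl = window-occursAt z p L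

window-++ : ∀ z p a b → window z p (a + b) ≡ window z p a ++ window z (p + a) b
window-++ z p zero b = cong (λ q → window z q b) (sym (+-identityʳ p))
window-++ z p (suc a) b = cong (z p ∷_)
  (trans (window-++ z (suc p) a b) (cong (λ q → window z (suc p) a ++ window z q b) (sym (+-suc p a))))

window-snoc : ∀ z p n → window z p (suc n) ≡ window z p n ++ z (p + n) ∷ []
window-snoc z p n = trans (cong (window z p) (+-comm 1 n)) (window-++ z p n 1)

occursAt-++⁻ : ∀ z (A B : List ℕ) p → OccursAt z (A ++ B) p → OccursAt z A p × OccursAt z B (p + length A)
occursAt-++⁻ z [] B p o = tt , subst (OccursAt z B) (sym (+-identityʳ p)) o
occursAt-++⁻ z (a ∷ A) B p (e , o) with occursAt-++⁻ z A B (suc p) o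
... | oA , oB = (e , oA) , subst (OccursAt z B) (sym (+-suc p (length A))) oB

runs-head : ∀ b w → ∃ λ n → ∃ λ (R : List (ℕ × ℕ)) → runs (b ∷ w) ≡ (b , n) ∷ R
runs-head b w with runs w
... | [] = 1 , [] , refl
... | (c , n) ∷ R with b ≡ᵇ c in e
...   | true rewrite ≡ᵇ-true⇒≡ b c e = suc n , R , refl
...   | false = 1 , (c , n) ∷ R , refl

runLengths-nonempty : ∀ a w → ∃ λ n → ∃ λ M → runLengths (a ∷ w) ≡ n ∷ M
runLengths-nonempty a w with runs-head a w
... | n , R , e = n , map proj₂ R , cong (map proj₂) e

-- consRuns n M β: the run lengths of a ∷ b ∷ w, where n ∷ M are those of
-- b ∷ w and β tells whether a = b.
consRuns : ℕ → List ℕ → Bool → List ℕ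
consRuns n M true = suc n ∷ M
consRuns n M false = 1 ∷ n ∷ M

runLengths-cons : ∀ a b w → ∃ λ n → ∃ λ M → runLengths (b ∷ w) ≡ n ∷ M ×
  runLengths (a ∷ b ∷ w) ≡ consRuns n M (a ≡ᵇ b)
runLengths-cons a b w with runs-head b w
... | n , R , e rewrite e with a ≡ᵇ b
...   | true = n , map proj₂ R , refl , refl
...   | false = n , map proj₂ R , refl , refl

runLengths-same : ∀ a b w n M → runLengths (b ∷ w) ≡ n ∷ M → a ≡ b → runLengths (a ∷ b ∷ w) ≡ suc n ∷ M
runLengths-same a b w n M e a≡b with runLengths-cons a b w
... | n' , M' , e₁ , e₂ with trans (sym e₁) e
...   | refl = trans e₂ (cong (consRuns n M) (≡⇒≡ᵇ-true a b a≡b))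

runLengths-new : ∀ a b w n M → runLengths (b ∷ w) ≡ n ∷ M → a ≢ b → runLengths (a ∷ b ∷ w) ≡ 1 ∷ n ∷ M
runLengths-new a b w n M e a≢b with runLengths-cons a b w
... | n' , M' , e₁ , e₂ with trans (sym e₁) e
...   | refl = trans e₂ (cong (consRuns n M) (≢⇒≡ᵇ-false a b a≢b))

PeriodicFrom : (ℕ → ℕ) → ℕ → ℕ → Set
PeriodicFrom z m q = ∀ i → m ≤ i → z i ≡ z (i + q)

periodic-change : ∀ z m q → PeriodicFrom z m q → ∀ A → m ≤ A → z A ≢ z (suc A) → z (A + q) ≢ z (suc A + q)
periodic-change z m q per A m≤A ne e = ne (trans (per A m≤A) (trans e (sym (per (suc A) (m≤n⇒m≤1+n m≤A)))))

periodic-const : ∀ z k t a → PeriodicFrom z k t → 1 ≤ t → (∀ d → d < t → z (k + d) ≡ a) →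
  ∀ d → z (k + d) ≡ a
periodic-const z k t a per 1≤t first d = below (suc d) d ≤-refl
  where
  below : ∀ n d → d < n → z (k + d) ≡ a
  below (suc n) d d<1+n with d <? t
  ... | yes d<t = first d d<t
  ... | no d≮t with m≤n⇒∃[o]m+o≡n (≮⇒≥ d≮t)
  ...   | d' , refl = begin
    z (k + (t + d'))  ≡⟨ cong z (trans (cong (k +_) (+-comm t d')) (sym (+-assoc k d' t))) ⟩
    z (k + d' + t)    ≡⟨ sym (per (k + d') (m≤m+n k d')) ⟩
    z (k + d')        ≡⟨ below n d' (≤-trans (+-monoˡ-≤ d' 1≤t) (s≤s⁻¹ d<1+n)) ⟩
    a                 ∎
    where open ≡-Reasoning

RunFrom : (ℕ → ℕ) → ℕ → ℕ → Set
RunFrom z B L = (∀ t → t < L → z (B + t) ≡ z B) × z (B + L) ≢ z B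

runFrom-unique : ∀ z B L L' → RunFrom z B L → RunFrom z B L' → L ≡ L'
runFrom-unique z B L L' (const , end) (const' , end') with <-cmp L L'
... | tri< L<L' _ _ = ⊥-elim (end (const' L L<L'))
... | tri≈ _ e _ = e
... | tri> _ _ L'<L = ⊥-elim (end' (const L' L'<L))

runFrom-shift : ∀ z m q → PeriodicFrom z m q → ∀ B L → m ≤ B → RunFrom z B L → RunFrom z (B + q) L
runFrom-shift z m q per B L m≤B (const , end) = const' , end'
  where
  shifted : ∀ t → z (B + q + t) ≡ z (B + t)
  shifted t = trans (cong z (xy∙z≈xz∙y B q t)) (sym (per (B + t) (≤-trans m≤B (m≤m+n B t))))
  const' : ∀ t → t < L → z (B + q + t) ≡ z (B + q)
  const' t t<L = trans (shifted t) (trans (const t t<L) (per B m≤B))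
  end' : z (B + q + L) ≢ z (B + q)
  end' e = end (trans (sym (shifted L)) (trans e (sym (per B m≤B))))

tight-sum : ∀ a b x → b ≤ a → 1 ≤ x → a + x ≡ suc b → a ≡ b × x ≡ 1
tight-sum a b x b≤a 1≤x e = a≡b , +-cancelˡ-≡ a x 1 (trans e (trans (cong suc (sym a≡b)) (+-comm 1 a)))
  where
  a≤b : a ≤ b
  a≤b = +-cancelʳ-≤ 1 a b (≤-trans (+-monoʳ-≤ a 1≤x) (≤-reflexive (trans e (+-comm 1 b))))
  a≡b : a ≡ b
  a≡b = ≤-antisym a≤b b≤a

offset<length : ∀ t u {x} → x ≡ t + suc u → t < x
offset<length t u e = ≤-trans (≤-trans (s≤s (m≤m+n t u)) (≤-reflexive (sym (+-suc t u)))) (≤-reflexive (sym e))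

module Blocks (z : ℕ → ℕ) (kol : Kolakoski z) where

  letter : ℕ → ℕ
  letter k = z (pos z k)

  letter-changes : ∀ k → letter (suc k) ≢ letter k
  letter-changes k = proj₂ (kol k)

  inBlock : ∀ k t → t < z k → z (pos z k + t) ≡ letter k
  inBlock k t t<zk = proj₁ (kol k) (pos z k + t) (m≤m+n _ _) (+-monoʳ-< (pos z k) t<zk)

  block-run : ∀ k → RunFrom z (pos z k) (z k)
  block-run k = inBlock k , letter-changes k

  -- An empty block k would give blocks k and k+1 the same letter.
  block-nonempty : ∀ k → 1 ≤ z k
  block-nonempty k with z k in eq
  ... | suc _ = s≤s z≤n
  ... | zero = ⊥-elim (letter-changes k (cong z (trans (cong (pos z k +_) eq) (+-identityʳ _))))

  -- Since blocks are nonempty, the t blocks after block k cover at least t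
  -- positions; in particular block starts are monotone and pos z k ≥ k.
  pos-+ : ∀ k t → pos z k + t ≤ pos z (k + t)
  pos-+ k zero = ≤-reflexive (trans (+-identityʳ _) (cong (pos z) (sym (+-identityʳ k))))
  pos-+ k (suc t) = begin
    pos z k + suc t          ≡⟨ +-suc (pos z k) t ⟩
    suc (pos z k + t)        ≡⟨ +-comm 1 _ ⟩
    pos z k + t + 1          ≤⟨ +-mono-≤ (pos-+ k t) (block-nonempty (k + t)) ⟩
    pos z (suc (k + t))      ≡⟨ cong (pos z) (sym (+-suc k t)) ⟩
    pos z (k + suc t)        ∎
    where open ≤-Reasoning

  pos-≥ : ∀ k → k ≤ pos z k
  pos-≥ k = pos-+ 0 k

  pos-mono : ∀ j k → j ≤ k → pos z j ≤ pos z k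
  pos-mono j k j≤k with m≤n⇒∃[o]m+o≡n j≤k
  ... | t , refl = ≤-trans (m≤m+n _ t) (pos-+ j t)

  locate : ∀ p → ∃ λ k → ∃ λ t → ∃ λ u → p ≡ pos z k + t × z k ≡ t + suc u
  locate zero with z 0 in e | block-nonempty 0
  ... | suc u | _ = 0 , 0 , u , refl , e
  locate (suc p) with locate p
  ... | k , t , suc u , ep , ez = k , suc t , u , trans (cong suc ep) (sym (+-suc _ t)) , trans ez (+-suc t (suc u))
  ... | k , t , zero , ep , ez with z (suc k) in e | block-nonempty (suc k)
  ...   | suc u | _ = suc k , 0 , u , p+1≡next , e
    where
    p+1≡next : suc p ≡ pos z (suc k) + 0
    p+1≡next = trans (cong suc ep) (trans (sym (+-suc _ t))
      (trans (cong (pos z k +_) (trans (+-comm 1 t) (sym ez))) (sym (+-identityʳ _))))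

  unit-blocks : ∀ k t → pos z (k + t) ≡ pos z k + t → ∀ d → d < t → z (k + d) ≡ 1
  unit-blocks k (suc t) e d d<1+t
    with tight-sum (pos z (k + t)) (pos z k + t) (z (k + t)) (pos-+ k t) (block-nonempty (k + t))
           (trans (sym (cong (pos z) (+-suc k t))) (trans e (+-suc (pos z k) t)))
  ... | e' , zkt≡1 with m≤n⇒m<n∨m≡n (s≤s⁻¹ d<1+t)
  ...   | inj₁ d<t = unit-blocks k t e' d d<t
  ...   | inj₂ refl = zkt≡1

  -- A period q ≥ 1 from m on maps the block boundary pos z (m+1) onto a later
  -- block boundary: otherwise the letter change at that boundary would be
  -- carried into the interior of a block.
  boundary-shift : ∀ m q → PeriodicFrom z m q → 1 ≤ q →
    ∃ λ j → suc m < j × pos z j ≡ pos z (suc m) + q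
  boundary-shift m q per 1≤q = onBoundary (locate (pos z (suc m) + q))
    where
    v = proj₁ (m≤n⇒∃[o]m+o≡n (block-nonempty m))
    1+v≡zm : suc v ≡ z m
    1+v≡zm = proj₂ (m≤n⇒∃[o]m+o≡n (block-nonempty m))
    A = pos z m + v
    next≡1+A : pos z (suc m) ≡ suc A
    next≡1+A = trans (cong (pos z m +_) (sym 1+v≡zm)) (+-suc (pos z m) v)
    change : z A ≢ z (suc A)
    change e = letter-changes m (trans (cong z next≡1+A) (trans (sym e) (inBlock m v (≤-reflexive 1+v≡zm))))
    m≤A : m ≤ A
    m≤A = ≤-trans (pos-≥ m) (m≤m+n _ v)
    onBoundary : (∃ λ j → ∃ λ t → ∃ λ u → pos z (suc m) + q ≡ pos z j + t × z j ≡ t + suc u) →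
      ∃ λ j → suc m < j × pos z j ≡ pos z (suc m) + q
    onBoundary (j , zero , _ , ep , _) = j , after , sym (trans ep (+-identityʳ _))
      where
      after : suc m < j
      after = ≰⇒> λ j≤1+m → <⇒≱ boundary<pos-j (pos-mono j (suc m) j≤1+m)
        where
        boundary<pos-j : pos z (suc m) < pos z j
        boundary<pos-j = begin-strict
          pos z (suc m)      <⟨ m<m+n _ 1≤q ⟩
          pos z (suc m) + q  ≡⟨ trans ep (+-identityʳ _) ⟩
          pos z j            ∎
          where open ≤-Reasoning
    onBoundary (j , suc t , u , ep , ez) = ⊥-elim (periodic-change z m q per A m≤A change
      (trans (cong z A+q≡) (trans (inBlock j t (≤-trans (n≤1+n _) t+1<zj)) (sym (trans (cong z 1+A+q≡) (inBlock j (suc t) t+1<zj))))))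
      where
      1+A+q≡ : suc A + q ≡ pos z j + suc t
      1+A+q≡ = trans (cong (_+ q) (sym next≡1+A)) ep
      A+q≡ : A + q ≡ pos z j + t
      A+q≡ = suc-injective (trans 1+A+q≡ (+-suc _ t))
      t+1<zj : suc t < z j
      t+1<zj = offset<length (suc t) u ez

  -- If translating by q maps boundary k onto boundary k+t, then (by induction
  -- on i, using that a period translates maximal runs) it maps every block
  -- k+i onto the block k+t+i; in particular the block lengths, i.e. z itself,
  -- have period t from k on.
  block-periodic : ∀ m q k t → PeriodicFrom z m q → m ≤ pos z k → pos z (k + t) ≡ pos z k + q →
    PeriodicFrom z k t
  block-periodic m q k t per m≤pos-k e i k≤i with m≤n⇒∃[o]m+o≡n k≤i
  ... | d , refl = trans (sym (same-length d)) (cong z (xy∙z≈xz∙y k t d))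
    where
    same-start : ∀ i → pos z (k + t + i) ≡ pos z (k + i) + q
    same-length : ∀ i → z (k + t + i) ≡ z (k + i)
    same-start zero = trans (cong (pos z) (+-identityʳ (k + t))) (trans e (cong (λ x → pos z x + q) (sym (+-identityʳ k))))
    same-start (suc i) = begin
      pos z (k + t + suc i)               ≡⟨ cong (pos z) (+-suc (k + t) i) ⟩
      pos z (k + t + i) + z (k + t + i)   ≡⟨ cong₂ _+_ (same-start i) (same-length i) ⟩
      pos z (k + i) + q + z (k + i)       ≡⟨ xy∙z≈xz∙y (pos z (k + i)) q (z (k + i)) ⟩
      pos z (k + i) + z (k + i) + q       ≡⟨ cong (λ x → pos z x + q) (sym (+-suc k i)) ⟩
      pos z (k + suc i) + q               ∎
      where open ≡-Reasoning
    same-length i = runFrom-unique z (pos z (k + t + i)) (z (k + t + i)) (z (k + i)) (block-run (k + t + i))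
      (subst (λ B → RunFrom z B (z (k + i))) (sym (same-start i))
        (runFrom-shift z m q per (pos z (k + i)) (z (k + i))
          (≤-trans m≤pos-k (pos-mono k (k + i) (m≤m+n k i))) (block-run (k + i))))

  -- Infinite descent step: a period q ≥ 1 yields a strictly smaller period t ≥ 1.
  -- The period t = j - k of the blocks is at most q since blocks are nonempty,
  -- and t = q would make all blocks from k on have length 1, so that z would
  -- be constant 1 from k on, contradicting that blocks k and k+1 differ.
  period-shrinks : ∀ m q → 1 ≤ q → PeriodicFrom z m q →
    ∃ λ k → ∃ λ t → 1 ≤ t × t < q × PeriodicFrom z k t
  period-shrinks m q 1≤q per with boundary-shift m q per 1≤q
  ... | j , k<j , e with m≤n⇒∃[o]m+o≡n (<⇒≤ k<j)
  ...   | t , refl = k , t , 1≤t , t<q , per'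
    where
    k = suc m
    1≤t : 1 ≤ t
    1≤t = ≰⇒> λ { t≤0 → <⇒≱ k<j (≤-reflexive (trans (cong (k +_) (n≤0⇒n≡0 t≤0)) (+-identityʳ k))) }
    per' : PeriodicFrom z k t
    per' = block-periodic m q k t per (≤-trans (n≤1+n m) (pos-≥ k)) e
    t≤q : t ≤ q
    t≤q = +-cancelˡ-≤ (pos z k) t q (≤-trans (pos-+ k t) (≤-reflexive e))
    t≢q : t ≢ q
    t≢q refl = letter-changes k (trans (ones (pos z (suc k)) (≤-trans (n≤1+n k) (pos-≥ (suc k))))
                                       (sym (ones (pos z k) (pos-≥ k))))
      where
      ones : ∀ i → k ≤ i → z i ≡ 1
      ones i k≤i with m≤n⇒∃[o]m+o≡n k≤i
      ... | d , refl = periodic-const z k t 1 per' 1≤t (unit-blocks k t e) d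
    t<q : t < q
    t<q = ≤∧≢⇒< t≤q t≢q

  no-period : ∀ n q → q ≤ n → 1 ≤ q → ∀ m → ¬ PeriodicFrom z m q
  no-period zero q q≤0 1≤q m per = <⇒≱ 1≤q q≤0
  no-period (suc n) q q≤1+n 1≤q m per with period-shrinks m q 1≤q per
  ... | k , t , 1≤t , t<q , per' = no-period n t (s≤s⁻¹ (≤-trans t<q q≤1+n)) 1≤t k per'

  not-eventually-periodic : ¬ EventuallyPeriodic z
  not-eventually-periodic (m , q , 1≤q , repeats) = no-period q q ≤-refl 1≤q m
    (λ i m≤i → trans (cong z (sym (+-identityʳ i))) (trans (repeats i m≤i 0 1≤q) (cong z (+-identityʳ _))))

Diter-shift : ∀ r s k w → Diter r s k (D r s w) ≡ Diter r s (suc k) w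
Diter-shift r s zero w = refl
Diter-shift r s (suc k) w = cong (D r s) (Diter-shift r s k w)

Diter-[] : ∀ r s k → Diter r s k [] ≡ []
Diter-[] r s zero = refl
Diter-[] r s (suc k) = cong (D r s) (Diter-[] r s k)

CInfinity-D : ∀ r s w → CInfinity r s w → CInfinity r s (D r s w)
CInfinity-D r s w cw k = subst (OverAlphabet r s) (sym (Diter-shift r s k w)) (cw (suc k))

length≤sum : ∀ M → All (1 ≤_) M → length M ≤ sum M
length≤sum [] _ = z≤n
length≤sum (x ∷ M) (1≤x ∷ ps) = +-mono-≤ 1≤x (length≤sum M ps)

init-last : ∀ (y : ℕ) L → ∃ λ M → ∃ λ y' → y ∷ L ≡ M ++ y' ∷ []
init-last y [] = [] , y , refl
init-last y (y₂ ∷ L) with init-last y₂ L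
... | M , y' , e = y ∷ M , y' , cong (y ∷_) e

module Letters (r s : ℕ) (r<s : r < s) where

  IsLetter : ℕ → Set
  IsLetter a = a ≡ r ⊎ a ≡ s

  mir : ℕ → ℕ
  mir = mirror r s

  s≢r : s ≢ r
  s≢r e = <⇒≢ r<s (sym e)

  mirror-r : mir r ≡ s
  mirror-r rewrite ≡⇒≡ᵇ-true r r refl = refl

  mirror-s : mir s ≡ r
  mirror-s rewrite ≢⇒≡ᵇ-false s r s≢r = refl

  mirror-isLetter : ∀ a → IsLetter (mir a)
  mirror-isLetter a with a ≡ᵇ r
  ... | true = inj₂ refl
  ... | false = inj₁ refl

  mirror-involutive : ∀ a → IsLetter a → mir (mir a) ≡ a
  mirror-involutive a (inj₁ refl) = trans (cong mir mirror-r) mirror-s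
  mirror-involutive a (inj₂ refl) = trans (cong mir mirror-s) mirror-r

  other-letter : ∀ a b → IsLetter a → IsLetter b → b ≢ a → b ≡ mir a
  other-letter a b (inj₁ refl) (inj₁ refl) b≢a = ⊥-elim (b≢a refl)
  other-letter a b (inj₁ refl) (inj₂ refl) _ = sym mirror-r
  other-letter a b (inj₂ refl) (inj₁ refl) _ = sym mirror-s
  other-letter a b (inj₂ refl) (inj₂ refl) b≢a = ⊥-elim (b≢a refl)

  mirror-≡ᵇ : ∀ a b → IsLetter a → IsLetter b → (mir a ≡ᵇ mir b) ≡ (a ≡ᵇ b)
  mirror-≡ᵇ a b ha hb with a ≟ b
  ... | yes refl = trans (≡⇒≡ᵇ-true (mir a) (mir a) refl) (sym (≡⇒≡ᵇ-true a a refl))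
  ... | no a≢b = trans (≢⇒≡ᵇ-false (mir a) (mir b) mir-a≢mir-b) (sym (≢⇒≡ᵇ-false a b a≢b))
    where
    mir-a≢mir-b : mir a ≢ mir b
    mir-a≢mir-b e = a≢b (trans (sym (mirror-involutive a ha)) (trans (cong mir e) (mirror-involutive b hb)))

  map-mirror-involutive : ∀ w → OverAlphabet r s w → map mir (map mir w) ≡ w
  map-mirror-involutive [] _ = refl
  map-mirror-involutive (a ∷ w) (ha ∷ hw) = cong₂ _∷_ (mirror-involutive a ha) (map-mirror-involutive w hw)

  mirror-overAlphabet : ∀ w → OverAlphabet r s (map mir w)
  mirror-overAlphabet [] = []
  mirror-overAlphabet (a ∷ w) = mirror-isLetter a ∷ mirror-overAlphabet w

  runLengths-mirror : ∀ w → OverAlphabet r s w → runLengths (map mir w) ≡ runLengths w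
  runLengths-mirror [] _ = refl
  runLengths-mirror (a ∷ []) _ = refl
  runLengths-mirror (a ∷ b ∷ w) (ha ∷ hb ∷ hw)
    with runLengths-mirror (b ∷ w) (hb ∷ hw) | runLengths-cons (mir a) (mir b) (map mir w) | runLengths-cons a b w
  ... | ih | n₁ , M₁ , f₁ , f₂ | n₂ , M₂ , g₁ , g₂ with trans (sym f₁) (trans ih g₁)
  ...   | refl = trans f₂ (trans (cong (consRuns n₁ M₁) (mirror-≡ᵇ a b ha hb)) (sym g₂))

  Diter-mirror : ∀ k w → OverAlphabet r s w → Diter r s (suc k) (map mir w) ≡ Diter r s (suc k) w
  Diter-mirror zero w hw = cong (Dlens r s) (runLengths-mirror w hw)
  Diter-mirror (suc k) w hw = cong (D r s) (Diter-mirror k w hw)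

  CInfinity-mirror : ∀ w → CInfinity r s w → CInfinity r s (map mir w)
  CInfinity-mirror w cw zero = mirror-overAlphabet w
  CInfinity-mirror w cw (suc k) = subst (OverAlphabet r s) (sym (Diter-mirror k w (cw 0))) (cw (suc k))

  alternate : ℕ → List ℕ → List ℕ
  alternate a [] = []
  alternate a (ℓ ∷ L) = replicate ℓ a ++ alternate (mir a) L

  length-alternate : ∀ a L → length (alternate a L) ≡ sum L
  length-alternate a [] = refl
  length-alternate a (ℓ ∷ L) = trans (length-++ (replicate ℓ a)) (cong₂ _+_ (length-replicate ℓ) (length-alternate (mir a) L))

  mirror-alternate : ∀ a L → map mir (alternate a L) ≡ alternate (mir a) L
  mirror-alternate a [] = refl
  mirror-alternate a (ℓ ∷ L) = trans (map-++ mir (replicate ℓ a) _) (cong₂ _++_ (map-replicate mir ℓ a) (mirror-alternate (mir a) L))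

  Positive : ℕ → Set
  Positive x = 1 ≤ x

  alternate-runLengths : ∀ a w → IsLetter a → OverAlphabet r s w →
    (a ∷ w ≡ alternate a (runLengths (a ∷ w))) × All Positive (runLengths (a ∷ w))
  alternate-runLengths a [] ha hw = refl , (s≤s z≤n ∷ [])
  alternate-runLengths a (b ∷ w) ha (hb ∷ hw) with alternate-runLengths b w hb hw | runLengths-cons a b w
  ... | e , positive-b | n , M , e₁ , e₂ =
    subst (λ L → a ∷ b ∷ w ≡ alternate a L) (sym e₂) (trans (cong (a ∷_) (trans e (cong (alternate b) e₁))) next) ,
    subst (All Positive) (sym e₂) (positive (a ≡ᵇ b) (subst (All Positive) e₁ positive-b))
    where
    next : a ∷ alternate b (n ∷ M) ≡ alternate a (consRuns n M (a ≡ᵇ b))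
    next with a ≟ b
    ... | yes a≡b rewrite ≡⇒≡ᵇ-true a b a≡b = cong (λ x → a ∷ alternate x (n ∷ M)) (sym a≡b)
    ... | no a≢b rewrite ≢⇒≡ᵇ-false a b a≢b = cong (λ x → a ∷ alternate x (n ∷ M)) (other-letter a b ha hb (a≢b ∘ sym))
    positive : ∀ β → All Positive (n ∷ M) → All Positive (consRuns n M β)
    positive true (_ ∷ ps) = s≤s z≤n ∷ ps
    positive false ps = s≤s z≤n ∷ ps

  adj-short : ∀ x → x ≤ r → adj r s x ≡ []
  adj-short x x≤r with x ≤ᵇ r | ≤⇒≤ᵇ x≤r
  ... | true | _ = refl

  adj-middle : ∀ x → r < x → x ≤ s → adj r s x ≡ s ∷ []
  adj-middle x r<x x≤s with x ≤ᵇ r in e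
  ... | true = ⊥-elim (<⇒≱ r<x (≤ᵇ⇒≤ x r (subst T (sym e) tt)))
  ... | false with x ≤ᵇ s | ≤⇒≤ᵇ x≤s
  ...   | true | _ = refl

  adj-long : ∀ x → s < x → adj r s x ≡ x ∷ []
  adj-long x s<x with x ≤ᵇ r in e
  ... | true = ⊥-elim (<⇒≱ (<-trans r<s s<x) (≤ᵇ⇒≤ x r (subst T (sym e) tt)))
  ... | false with x ≤ᵇ s in e₂
  ...   | true = ⊥-elim (<⇒≱ s<x (≤ᵇ⇒≤ x s (subst T (sym e₂) tt)))
  ...   | false = refl

  adj-cases : ∀ x → x ≤ s → (x ≤ r × adj r s x ≡ []) ⊎ (r < x × adj r s x ≡ s ∷ [])
  adj-cases x x≤s with x ≤? r
  ... | yes x≤r = inj₁ (x≤r , adj-short x x≤r)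
  ... | no x≰r = inj₂ (≰⇒> x≰r , adj-middle x (≰⇒> x≰r) x≤s)

  adj-overAlphabet : ∀ x → OverAlphabet r s (adj r s x) → x ≤ s
  adj-overAlphabet x hx with x ≤? s
  ... | yes x≤s = x≤s
  ... | no x≰s with subst (OverAlphabet r s) (adj-long x (≰⇒> x≰s)) hx
  ...   | inj₁ e ∷ _ = ⊥-elim (x≰s (≤-trans (≤-reflexive e) (<⇒≤ r<s)))
  ...   | inj₂ e ∷ _ = ⊥-elim (x≰s (≤-reflexive e))

  -- For r ≥ 1, altering a nonempty run strictly shortens it; this makes D
  -- length-decreasing, which drives the induction on the length of C∞-words.
  adj-shorter : 1 ≤ r → ∀ x → 1 ≤ x → length (adj r s x) < x
  adj-shorter 1≤r x 1≤x with x ≤? s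
  ... | no x≰s = subst (λ L → length L < x) (sym (adj-long x (≰⇒> x≰s))) (≤-trans (s≤s 1≤r) (≤-trans r<s (<⇒≤ (≰⇒> x≰s))))
  ... | yes x≤s with adj-cases x x≤s
  ...   | inj₁ (_ , e) = subst (λ L → length L < x) (sym e) 1≤x
  ...   | inj₂ (r<x , e) = subst (λ L → length L < x) (sym e) (≤-trans (s≤s 1≤r) r<x)

  Dlens-single-overAlphabet : ∀ x → OverAlphabet r s (Dlens r s (x ∷ [])) → x ≤ s
  Dlens-single-overAlphabet x hx with x <ᵇ s in e
  ... | true = <⇒≤ (<ᵇ⇒< x s (subst T (sym e) tt))
  ... | false = adj-overAlphabet x hx

  adjLast-snoc : ∀ M y → adjLast r s (M ++ y ∷ []) ≡ M ++ adj r s y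
  adjLast-snoc [] y = refl
  adjLast-snoc (x ∷ []) y = refl
  adjLast-snoc (x ∷ x₂ ∷ M) y = cong (x ∷_) (adjLast-snoc (x₂ ∷ M) y)

  Dlens-ends : ∀ x M y → Dlens r s (x ∷ M ++ y ∷ []) ≡ adj r s x ++ M ++ adj r s y
  Dlens-ends x [] y = refl
  Dlens-ends x (x₂ ∷ M) y = cong (adj r s x ++_) (adjLast-snoc (x₂ ∷ M) y)

  -- The one-letter word s is C∞ when s ≥ 2, since then D(s) is empty.
  s-CInfinity : 1 < s → CInfinity r s (s ∷ [])
  s-CInfinity 1<s zero = inj₂ refl ∷ []
  s-CInfinity 1<s (suc k) = subst (OverAlphabet r s) vanishes []
    where
    D-s : D r s (s ∷ []) ≡ []
    D-s with 1 <ᵇ s | <⇒<ᵇ 1<s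
    ... | true | _ = refl
    vanishes : [] ≡ Diter r s (suc k) (s ∷ [])
    vanishes = sym (trans (sym (Diter-shift r s k (s ∷ []))) (trans (cong (Diter r s k) D-s) (Diter-[] r s k)))

  ends-shorter : 1 ≤ r → ∀ x M y → All Positive (x ∷ M ++ y ∷ []) →
    length (adj r s x ++ M ++ adj r s y) < sum (x ∷ M ++ y ∷ [])
  ends-shorter 1≤r x M y (1≤x ∷ ps) = begin-strict
    length (adj r s x ++ M ++ adj r s y)                  ≡⟨ length-++ (adj r s x) ⟩
    length (adj r s x) + length (M ++ adj r s y)          ≡⟨ cong (length (adj r s x) +_) (length-++ M) ⟩
    length (adj r s x) + (length M + length (adj r s y))
      <⟨ +-mono-<-≤ (adj-shorter 1≤r x 1≤x) (+-mono-≤ (length≤sum M psM) (<⇒≤ (adj-shorter 1≤r y 1≤y))) ⟩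
    x + (sum M + y)                                        ≡⟨ cong (x +_) (cong (sum M +_) (sym (+-identityʳ y))) ⟩
    x + (sum M + sum (y ∷ []))                             ≡⟨ cong (x +_) (sym (sum-++ M (y ∷ []))) ⟩
    sum (x ∷ M ++ y ∷ [])                                  ∎
    where
    open ≤-Reasoning
    psM : All Positive M
    psM = proj₁ (AllP.++⁻ M ps)
    1≤y : 1 ≤ y
    1≤y with proj₂ (AllP.++⁻ M ps)
    ... | p ∷ [] = p

module KolakoskiOver (r s : ℕ) (r<s : r < s) (z : ℕ → ℕ) (alph : SeqOverAlphabet r s z) (kol : Kolakoski z) where

  open Blocks z kol
  open Letters r s r<s

  letter-isLetter : ∀ k → IsLetter (letter k)
  letter-isLetter k = alph (pos z k)

  letter-next : ∀ k → letter (suc k) ≡ mir (letter k)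
  letter-next k = other-letter (letter k) (letter (suc k)) (letter-isLetter k) (letter-isLetter (suc k)) (letter-changes k)

  z≤s : ∀ k → z k ≤ s
  z≤s k with alph k
  ... | inj₁ e = ≤-trans (≤-reflexive e) (<⇒≤ r<s)
  ... | inj₂ e = ≤-reflexive e

  r≤z : ∀ k → r ≤ z k
  r≤z k with alph k
  ... | inj₁ e = ≤-reflexive (sym e)
  ... | inj₂ e = ≤-trans (<⇒≤ r<s) (≤-reflexive (sym e))

  -- r = 0 is impossible: blocks are nonempty, so z would be constantly s,
  -- and the first two blocks would carry the same letter.
  1≤r : 1 ≤ r
  1≤r with r ≟ 0
  ... | no r≢0 = n≢0⇒n>0 r≢0
  ... | yes r≡0 = ⊥-elim (letter-changes 0 (trans (always-s (pos z 1)) (sym (always-s 0))))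
    where
    always-s : ∀ i → z i ≡ s
    always-s i with alph i
    ... | inj₂ e = e
    ... | inj₁ e = ⊥-elim (<⇒≢ (block-nonempty i) (sym (trans e r≡0)))

  1<s : 1 < s
  1<s = ≤-trans (s≤s 1≤r) r<s

  factor-overAlphabet : ∀ w p → OccursAt z w p → OverAlphabet r s w
  factor-overAlphabet [] p o = []
  factor-overAlphabet (a ∷ w) p (e , o) = subst IsLetter e (alph p) ∷ factor-overAlphabet w (suc p) o

  -- Shape of the run lengths of a window of length L+1 starting at a position p
  -- of block k that is followed by u further positions of block k: either the
  -- window stays inside block k, or its runs are the rest of block k, the
  -- complete blocks k+1, …, k+n and a nonempty initial part of block k+n+1.
  -- Since the lengths of complete blocks are values of z, the middle part is
  -- itself a factor of z; this is the self-similarity behind the derivative.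
  WindowShape : ℕ → ℕ → ℕ → ℕ → Set
  WindowShape p L k u =
    (L ≤ u × runLengths (window z p (suc L)) ≡ suc L ∷ [])
    ⊎ (∃ λ n → ∃ λ y → 1 ≤ y × y ≤ z (suc k + n) ×
         runLengths (window z p (suc L)) ≡ suc u ∷ window z (suc k) n ++ y ∷ [])

  -- By induction on L, adding the letter z p in front of the window at p+1:
  -- inside block k it lengthens the first run, and at the last position of
  -- block k (u = 0) it forms a run of length 1 before the next block.
  window-shape : ∀ L p k t u → p ≡ pos z k + t → z k ≡ t + suc u → WindowShape p L k u
  window-shape zero p k t u _ _ = inj₁ (z≤n , refl)
  window-shape (suc L) p k t (suc u) ep ez = extend (window-shape L (suc p) k (suc t) u ep' ez')
    where
    ep' : suc p ≡ pos z k + suc t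
    ep' = trans (cong suc ep) (sym (+-suc _ t))
    ez' : z k ≡ suc t + suc u
    ez' = trans ez (+-suc t (suc u))
    same : z p ≡ z (suc p)
    same = trans (cong z ep) (trans (inBlock k t (offset<length t (suc u) ez))
             (sym (trans (cong z ep') (inBlock k (suc t) (offset<length (suc t) u ez')))))
    runs≡ : ∀ {n M} → runLengths (window z (suc p) (suc L)) ≡ n ∷ M → runLengths (window z p (suc (suc L))) ≡ suc n ∷ M
    runs≡ e = runLengths-same (z p) (z (suc p)) (window z (suc (suc p)) L) _ _ e same
    extend : WindowShape (suc p) L k u → WindowShape p (suc L) k (suc u)
    extend (inj₁ (L≤u , e)) = inj₁ (s≤s L≤u , runs≡ e)
    extend (inj₂ (n , y , 1≤y , y≤z , e)) = inj₂ (n , y , 1≤y , y≤z , runs≡ e)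
  window-shape (suc L) p k t zero ep ez = extend (window-shape L (suc p) (suc k) 0 u' ep' (sym 1+u'≡z))
    where
    u' = proj₁ (m≤n⇒∃[o]m+o≡n (block-nonempty (suc k)))
    1+u'≡z : suc u' ≡ z (suc k)
    1+u'≡z = proj₂ (m≤n⇒∃[o]m+o≡n (block-nonempty (suc k)))
    1+p≡next : suc p ≡ pos z (suc k)
    1+p≡next = trans (cong suc ep) (trans (sym (+-suc _ t)) (cong (pos z k +_) (trans (+-comm 1 t) (sym ez))))
    ep' : suc p ≡ pos z (suc k) + 0
    ep' = trans 1+p≡next (sym (+-identityʳ _))
    differ : z p ≢ z (suc p)
    differ e = letter-changes k (trans (cong z (sym 1+p≡next)) (trans (sym e)
                 (trans (cong z ep) (inBlock k t (offset<length t 0 ez)))))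
    runs≡ : ∀ {n M} → runLengths (window z (suc p) (suc L)) ≡ n ∷ M → runLengths (window z p (suc (suc L))) ≡ 1 ∷ n ∷ M
    runs≡ e = runLengths-new (z p) (z (suc p)) (window z (suc (suc p)) L) _ _ e differ
    extend : WindowShape (suc p) L (suc k) u' → WindowShape p (suc L) k zero
    extend (inj₁ (L≤u' , e)) =
      inj₂ (0 , suc L , s≤s z≤n , ≤-trans (s≤s L≤u') (≤-reflexive (trans 1+u'≡z (cong z (sym (+-identityʳ (suc k)))))) , runs≡ e)
    extend (inj₂ (n , y , 1≤y , y≤z , e)) =
      inj₂ (suc n , y , 1≤y , subst (λ i → y ≤ z i) (sym (+-suc (suc k) n)) y≤z ,
            trans (runs≡ e) (cong (λ x → 1 ∷ x ∷ window z (suc (suc k)) n ++ y ∷ []) 1+u'≡z))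

  adj-within : ∀ x j → x ≤ z j → adj r s x ≡ [] ⊎ adj r s x ≡ z j ∷ []
  adj-within x j x≤zj with adj-cases x (≤-trans x≤zj (z≤s j))
  ... | inj₁ (_ , e) = inj₁ e
  ... | inj₂ (r<x , e) with alph j
  ...   | inj₁ zj≡r = ⊥-elim (<⇒≱ r<x (≤-trans x≤zj (≤-reflexive zj≡r)))
  ...   | inj₂ zj≡s = inj₂ (trans e (cong (_∷ []) (sym zj≡s)))

  occurs-window : ∀ {v} p L → window z p L ≡ v → Occurs z v
  occurs-window p L e = p , window⇒occursAt z p L e

  Dlens-single-occurs : ∀ x k → x ≤ z k → Occurs z (Dlens r s (x ∷ []))
  Dlens-single-occurs x k x≤zk with x <ᵇ s in e
  ... | true = 0 , tt
  ... | false = k , subst (λ L → OccursAt z L k) (sym adj≡s) (zk≡s , tt)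
    where
    s≤x : s ≤ x
    s≤x = ≮⇒≥ (λ x<s → subst T e (<⇒<ᵇ x<s))
    zk≡s : z k ≡ s
    zk≡s = ≤-antisym (z≤s k) (≤-trans s≤x x≤zk)
    adj≡s : adj r s x ≡ s ∷ []
    adj≡s = adj-middle x (<-≤-trans r<s s≤x) (≤-trans x≤zk (z≤s k))

  ends-occur : ∀ k n x y → adj r s x ≡ [] ⊎ adj r s x ≡ z k ∷ [] →
    adj r s y ≡ [] ⊎ adj r s y ≡ z (suc k + n) ∷ [] →
    Occurs z (adj r s x ++ window z (suc k) n ++ adj r s y)
  ends-occur k n x y (inj₁ ex) (inj₁ ey) rewrite ex | ey = occurs-window (suc k) n (sym (++-identityʳ _))
  ends-occur k n x y (inj₂ ex) (inj₁ ey) rewrite ex | ey = occurs-window k (suc n) (cong (z k ∷_) (sym (++-identityʳ _)))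
  ends-occur k n x y (inj₁ ex) (inj₂ ey) rewrite ex | ey = occurs-window (suc k) (suc n) (window-snoc z (suc k) n)
  ends-occur k n x y (inj₂ ex) (inj₂ ey) rewrite ex | ey = occurs-window k (suc (suc n)) (cong (z k ∷_) (window-snoc z (suc k) n))

  derivative-occurs : ∀ w p → OccursAt z w p → Occurs z (D r s w)
  derivative-occurs [] p o = 0 , tt
  derivative-occurs (a ∷ w) p o with locate p
  ... | k , t , u , ep , ez = subst (λ v → Occurs z (D r s v)) (occursAt⇒window z (a ∷ w) p o)
                                    (fromShape (window-shape (length w) p k t u ep ez))
    where
    rest≤zk : suc u ≤ z k
    rest≤zk = ≤-trans (m≤n+m (suc u) t) (≤-reflexive (sym ez))
    fromShape : WindowShape p (length w) k u → Occurs z (D r s (window z p (suc (length w))))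
    fromShape (inj₁ (L≤u , e)) rewrite e = Dlens-single-occurs (suc (length w)) k (≤-trans (s≤s L≤u) rest≤zk)
    fromShape (inj₂ (n , y , _ , y≤z , e)) rewrite e | Dlens-ends (suc u) (window z (suc k) n) y =
      ends-occur k n (suc u) y (adj-within (suc u) k rest≤zk) (adj-within y (suc k + n) y≤z)

  Diter-occurs : ∀ k w → Occurs z w → Occurs z (Diter r s k w)
  Diter-occurs zero w o = o
  Diter-occurs (suc k) w o with Diter-occurs k w o
  ... | p , o' = derivative-occurs (Diter r s k w) p o'

  factor-CInfinity : ∀ w → Occurs z w → CInfinity r s w
  factor-CInfinity w o k with Diter-occurs k w o
  ... | p , o' = factor-overAlphabet _ p o'

  CInfinity-occur⇒mirrorInvariant : (∀ w → CInfinity r s w → Occurs z w) → MirrorInvariant r s z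
  CInfinity-occur⇒mirrorInvariant every w hw =
    (λ o → every _ (CInfinity-mirror w (factor-CInfinity w o))) ,
    (λ o → subst (Occurs z) (map-mirror-involutive w hw) (every _ (CInfinity-mirror _ (factor-CInfinity _ o))))

  window-in-block : ∀ j t L → t + L ≤ z j → window z (pos z j + t) L ≡ replicate L (letter j)
  window-in-block j t zero _ = refl
  window-in-block j t (suc L) t+L+1≤zj = cong₂ _∷_ (inBlock j t (≤-trans (offset<length t L refl) t+L+1≤zj))
    (trans (cong (λ q → window z q L) (sym (+-suc _ t)))
           (window-in-block j (suc t) L (≤-trans (≤-reflexive (sym (+-suc t L))) t+L+1≤zj)))

  window-from-block : ∀ j e x R → e + x ≡ z j →
    window z (pos z j + e) (x + R) ≡ replicate x (letter j) ++ window z (pos z (suc j)) R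
  window-from-block j e x R e+x≡zj = trans (window-++ z (pos z j + e) x R)
    (cong₂ _++_ (window-in-block j e x (≤-reflexive e+x≡zj))
                (cong (λ q → window z q R) (trans (+-assoc (pos z j) e x) (cong (pos z j +_) e+x≡zj))))

  window-blocks : ∀ n j e x y → e + x ≡ z j → y ≤ z (suc j + n) →
    window z (pos z j + e) (x + (sum (window z (suc j) n) + y)) ≡ alternate (letter j) (x ∷ window z (suc j) n ++ y ∷ [])
  window-blocks zero j e x y e+x≡zj y≤z = begin
    window z (pos z j + e) (x + y)                   ≡⟨ window-from-block j e x y e+x≡zj ⟩
    replicate x (letter j) ++ window z (pos z (suc j)) y
      ≡⟨ cong (replicate x (letter j) ++_) (trans (cong (λ q → window z q y) (sym (+-identityʳ _)))
                                                   (window-in-block (suc j) 0 y (≤-trans y≤z (≤-reflexive (cong z (+-identityʳ (suc j))))))) ⟩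
    replicate x (letter j) ++ replicate y (letter (suc j))
      ≡⟨ cong (λ b → replicate x (letter j) ++ b) (trans (cong (replicate y) (letter-next j)) (sym (++-identityʳ _))) ⟩
    alternate (letter j) (x ∷ y ∷ [])                ∎
    where open ≡-Reasoning
  window-blocks (suc n) j e x y e+x≡zj y≤z = begin
    window z (pos z j + e) (x + (z (suc j) + S + y))
      ≡⟨ cong (λ L → window z (pos z j + e) (x + L)) (+-assoc (z (suc j)) S y) ⟩
    window z (pos z j + e) (x + (z (suc j) + (S + y)))
      ≡⟨ window-from-block j e x _ e+x≡zj ⟩
    replicate x (letter j) ++ window z (pos z (suc j)) (z (suc j) + (S + y))
      ≡⟨ cong (λ q → replicate x (letter j) ++ window z q (z (suc j) + (S + y))) (sym (+-identityʳ _)) ⟩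
    replicate x (letter j) ++ window z (pos z (suc j) + 0) (z (suc j) + (S + y))
      ≡⟨ cong (replicate x (letter j) ++_) (window-blocks n (suc j) 0 (z (suc j)) y refl (subst (λ i → y ≤ z i) (+-suc (suc j) n) y≤z)) ⟩
    replicate x (letter j) ++ alternate (letter (suc j)) (z (suc j) ∷ window z (suc (suc j)) n ++ y ∷ [])
      ≡⟨ cong (λ b → replicate x (letter j) ++ alternate b (z (suc j) ∷ window z (suc (suc j)) n ++ y ∷ [])) (letter-next j) ⟩
    alternate (letter j) (x ∷ window z (suc j) (suc n) ++ y ∷ [])  ∎
    where
    open ≡-Reasoning
    S = sum (window z (suc (suc j)) n)

  alternate-occurs : ∀ j n x y → x ≤ z j → y ≤ z (suc j + n) →
    ∃ λ q → pos z j ≤ q × OccursAt z (alternate (letter j) (x ∷ window z (suc j) n ++ y ∷ [])) q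
  alternate-occurs j n x y x≤zj y≤z with m≤n⇒∃[o]m+o≡n x≤zj
  ... | e , x+e≡zj = pos z j + e , m≤m+n _ e ,
    window⇒occursAt z (pos z j + e) _ (window-blocks n j e x y (trans (+-comm e x) x+e≡zj) y≤z)

  -- Under mirror invariance, an occurrence of the mirror image of w at q
  -- yields an occurrence of w at or after q: the mirror image of the prefix
  -- z_0 … z_{q+|w|-1} occurs somewhere, and it ends with w.
  mirror-later : MirrorInvariant r s z → ∀ w q → OverAlphabet r s w → OccursAt z (map mir w) q →
    ∃ λ i → q ≤ i × OccursAt z w i
  mirror-later mi w q hw o with proj₁ (mi u (factor-overAlphabet u 0 (window-occursAt z 0 _))) (0 , window-occursAt z 0 _)
    where u = window z 0 (q + length w)
  ... | p , o' = p + length A , ≤-trans (≤-reflexive (sym |A|≡q)) (m≤n+m _ p) ,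
                 proj₂ (occursAt-++⁻ z A w p (subst (λ v → OccursAt z v p) mirror-prefix o'))
    where
    A = map mir (window z 0 q)
    |A|≡q : length A ≡ q
    |A|≡q = trans (length-map mir (window z 0 q)) (length-window z 0 q)
    w-at-q : window z q (length w) ≡ map mir w
    w-at-q = trans (cong (window z q) (sym (length-map mir w))) (occursAt⇒window z (map mir w) q o)
    mirror-prefix : map mir (window z 0 (q + length w)) ≡ A ++ w
    mirror-prefix = begin
      map mir (window z 0 (q + length w))                ≡⟨ cong (map mir) (window-++ z 0 q (length w)) ⟩
      map mir (window z 0 q ++ window z q (length w))    ≡⟨ map-++ mir (window z 0 q) _ ⟩
      A ++ map mir (window z q (length w))               ≡⟨ cong (λ v → A ++ map mir v) w-at-q ⟩
      A ++ map mir (map mir w)                           ≡⟨ cong (A ++_) (map-mirror-involutive w hw) ⟩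
      A ++ w                                             ∎
      where open ≡-Reasoning

  up-to-mirror : ∀ a b L q → IsLetter a → IsLetter b → OccursAt z (alternate b L) q →
    OccursAt z (alternate a L) q ⊎ OccursAt z (map mir (alternate a L)) q
  up-to-mirror a b L q ha hb o with b ≟ a
  ... | yes refl = inj₁ o
  ... | no b≢a = inj₂ (subst (λ v → OccursAt z v q)
                   (trans (cong (λ x → alternate x L) (other-letter a b ha hb b≢a)) (sym (mirror-alternate a L))) o)

  OccursBeyondUpToMirror : List ℕ → ℕ → Set
  OccursBeyondUpToMirror w N = ∃ λ q → N ≤ q × (OccursAt z w q ⊎ OccursAt z (map mir w) q)

  C∞-OccurBeyond : ℕ → Set
  C∞-OccurBeyond n = ∀ v → length v ≤ n → CInfinity r s v → ∀ N → ∃ λ i → N ≤ i × OccursAt z v i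

  run-in-block : ∀ a ℓ j N → IsLetter a → N ≤ j → ℓ ≤ z j → OccursBeyondUpToMirror (alternate a (ℓ ∷ [])) N
  run-in-block a ℓ j N ha N≤j ℓ≤zj = pos z j + 0 , ≤-trans N≤j (≤-trans (pos-≥ j) (m≤m+n _ 0)) ,
    up-to-mirror a (letter j) (ℓ ∷ []) _ ha (letter-isLetter j)
      (window⇒occursAt z _ ℓ (trans (window-in-block j 0 ℓ ℓ≤zj) (sym (++-identityʳ _))))

  -- A single run of length ℓ ≤ s occurs beyond N up to mirroring: every block
  -- has length ≥ r, and for ℓ > r the shorter word s (ℓ ≥ 2) occurs beyond N,
  -- marking a block of length s.
  single-run-beyond : ∀ n → C∞-OccurBeyond n → ∀ a ℓ → IsLetter a → ℓ ≤ s → ℓ ≤ suc n →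
    ∀ N → OccursBeyondUpToMirror (alternate a (ℓ ∷ [])) N
  single-run-beyond n ih a ℓ ha ℓ≤s ℓ≤1+n N with ℓ ≤? r
  ... | yes ℓ≤r = run-in-block a ℓ N N ha ≤-refl (≤-trans ℓ≤r (r≤z N))
  ... | no ℓ≰r with ih (s ∷ []) (s≤s⁻¹ (≤-trans (≤-trans (s≤s 1≤r) (≰⇒> ℓ≰r)) ℓ≤1+n)) (s-CInfinity 1<s) N
  ...   | j , N≤j , zj≡s , _ = run-in-block a ℓ j N ha N≤j (≤-trans ℓ≤s (≤-reflexive (sym zj≡s)))

  -- An occurrence of adj x ++ V at i > N, with x ≤ s, determines a block
  -- j ≥ N that can hold a run of length x and is followed by V: if adj x is
  -- empty, take the block before i (all blocks have length ≥ r ≥ x), and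
  -- otherwise the block of length s at i.
  lift-left : ∀ N i x V → N < i → x ≤ s → OccursAt z (adj r s x ++ V) i →
    ∃ λ j → N ≤ j × x ≤ z j × OccursAt z V (suc j)
  lift-left N (suc i) x V (s≤s N≤i) x≤s o with adj-cases x x≤s
  ... | inj₁ (x≤r , e) = i , N≤i , ≤-trans x≤r (r≤z i) , subst (λ L → OccursAt z (L ++ V) (suc i)) e o
  ... | inj₂ (_ , e) with subst (λ L → OccursAt z (L ++ V) (suc i)) e o
  ...   | zi≡s , oV = suc i , m≤n⇒m≤1+n N≤i , ≤-trans x≤s (≤-reflexive (sym zi≡s)) , oV

  lift-right : ∀ j M y → y ≤ s → OccursAt z (M ++ adj r s y) (suc j) →
    M ≡ window z (suc j) (length M) × y ≤ z (suc j + length M)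
  lift-right j M y y≤s o with occursAt-++⁻ z M (adj r s y) (suc j) o
  ... | oM , oY = sym (occursAt⇒window z M (suc j) oM) , last-block (adj-cases y y≤s)
    where
    last-block : (y ≤ r × adj r s y ≡ []) ⊎ (r < y × adj r s y ≡ s ∷ []) → y ≤ z (suc j + length M)
    last-block (inj₁ (y≤r , _)) = ≤-trans y≤r (r≤z _)
    last-block (inj₂ (_ , e)) = ≤-trans y≤s (≤-reflexive (sym (proj₁ (subst (λ L → OccursAt z L _) e oY))))

  -- A word w with runs x, M, y: its derivative adj x ++ M ++ adj y is a
  -- shorter C∞-word, so it occurs beyond N; the lifting lemmas turn that
  -- occurrence into blocks j, …, j+|M|+1 from which w or its mirror image is cut.
  several-runs-beyond : ∀ n → C∞-OccurBeyond n → ∀ a w x M y → IsLetter a →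
    w ≡ alternate a (x ∷ M ++ y ∷ []) → runLengths w ≡ x ∷ M ++ y ∷ [] → All Positive (x ∷ M ++ y ∷ []) →
    length w ≤ suc n → CInfinity r s w → ∀ N → OccursBeyondUpToMirror w N
  several-runs-beyond n ih a w x M y ha w≡ runs≡ ps |w|≤ cw N =
    lift (ih (D r s w) |Dw|≤n (CInfinity-D r s w cw) (suc N))
    where
    Dw≡ : D r s w ≡ adj r s x ++ M ++ adj r s y
    Dw≡ = trans (cong (Dlens r s) runs≡) (Dlens-ends x M y)
    hD : OverAlphabet r s (adj r s x ++ M ++ adj r s y)
    hD = subst (OverAlphabet r s) Dw≡ (cw 1)
    x≤s : x ≤ s
    x≤s = adj-overAlphabet x (proj₁ (AllP.++⁻ (adj r s x) hD))
    y≤s : y ≤ s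
    y≤s = adj-overAlphabet y (proj₂ (AllP.++⁻ M (proj₂ (AllP.++⁻ (adj r s x) hD))))
    |Dw|≤n : length (D r s w) ≤ n
    |Dw|≤n = s≤s⁻¹ (begin-strict
      length (D r s w)                        ≡⟨ cong length Dw≡ ⟩
      length (adj r s x ++ M ++ adj r s y)    <⟨ ends-shorter 1≤r x M y ps ⟩
      sum (x ∷ M ++ y ∷ [])                   ≡⟨ sym (trans (cong length w≡) (length-alternate a (x ∷ M ++ y ∷ []))) ⟩
      length w                                ≤⟨ |w|≤ ⟩
      suc n                                   ∎)
      where open ≤-Reasoning
    lift : (∃ λ i → suc N ≤ i × OccursAt z (D r s w) i) → OccursBeyondUpToMirror w N
    lift (i , N<i , oD) with lift-left N i x (M ++ adj r s y) N<i x≤s (subst (λ v → OccursAt z v i) Dw≡ oD)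
    ... | j , N≤j , x≤zj , oMy with lift-right j M y y≤s oMy
    ...   | M≡ , y≤z with alternate-occurs j (length M) x y x≤zj y≤z
    ...     | q , pos-j≤q , o = q , ≤-trans N≤j (≤-trans (pos-≥ j) pos-j≤q) ,
      subst (λ v → OccursAt z v q ⊎ OccursAt z (map mir v) q) (sym w≡)
        (up-to-mirror a (letter j) (x ∷ M ++ y ∷ []) q ha (letter-isLetter j)
          (subst (λ L → OccursAt z (alternate (letter j) (x ∷ L ++ y ∷ [])) q) (sym M≡) o))

  occurs-beyond-up-to-mirror : ∀ n → C∞-OccurBeyond n → ∀ w → length w ≤ suc n → CInfinity r s w →
    ∀ N → OccursBeyondUpToMirror w N
  occurs-beyond-up-to-mirror n ih [] _ _ N = N , ≤-refl , inj₁ tt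
  occurs-beyond-up-to-mirror n ih (a ∷ w) |w|≤ cw N with cw 0
  ... | ha ∷ hw with alternate-runLengths a w ha hw | runLengths (a ∷ w) in runs≡
  ...   | w≡ , ps | [] with runLengths-nonempty a w
  ...     | _ , _ , e with trans (sym runs≡) e
  ...       | ()
  occurs-beyond-up-to-mirror n ih (a ∷ w) |w|≤ cw N | ha ∷ hw | w≡ , ps | ℓ ∷ [] =
    subst (λ v → OccursBeyondUpToMirror v N) (sym w≡′) (single-run-beyond n ih a ℓ ha ℓ≤s ℓ≤1+n N)
    where
    w≡′ : a ∷ w ≡ alternate a (ℓ ∷ [])
    w≡′ = trans w≡ (cong (alternate a) runs≡)
    ℓ≤s : ℓ ≤ s
    ℓ≤s = Dlens-single-overAlphabet ℓ (subst (λ L → OverAlphabet r s (Dlens r s L)) runs≡ (cw 1))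
    ℓ≤1+n : ℓ ≤ suc n
    ℓ≤1+n = subst (_≤ suc n) (trans (cong length w≡′) (trans (length-alternate a (ℓ ∷ [])) (+-identityʳ ℓ))) |w|≤
  occurs-beyond-up-to-mirror n ih (a ∷ w) |w|≤ cw N | ha ∷ hw | w≡ , ps | x ∷ ℓ ∷ L with init-last ℓ L
  ... | M , y , L≡ = several-runs-beyond n ih a (a ∷ w) x M y ha (trans w≡ (cong (alternate a) runs≡′))
        runs≡′ (subst (All Positive) runs≡′ ps) |w|≤ cw N
    where
    runs≡′ : runLengths (a ∷ w) ≡ x ∷ M ++ y ∷ []
    runs≡′ = trans runs≡ (cong (x ∷_) L≡)

  -- Under mirror invariance, every C∞-word occurs beyond every bound: an
  -- occurrence of its mirror image is turned into a later one of the word.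
  C∞-occur-beyond : MirrorInvariant r s z → ∀ n → C∞-OccurBeyond n
  C∞-occur-beyond mi zero [] _ _ N = N , ≤-refl , tt
  C∞-occur-beyond mi (suc n) v |v|≤ cv N with occurs-beyond-up-to-mirror n (C∞-occur-beyond mi n) v |v|≤ cv N
  ... | q , N≤q , inj₁ o = q , N≤q , o
  ... | q , N≤q , inj₂ o with mirror-later mi v q (cv 0) o
  ...   | i , q≤i , o' = i , ≤-trans N≤q q≤i , o'

  mirrorInvariant⇒CInfinity-occur : MirrorInvariant r s z → ∀ w → CInfinity r s w → Occurs z w
  mirrorInvariant⇒CInfinity-occur mi w cw with C∞-occur-beyond mi (length w) w ≤-refl cw 0
  ... | i , _ , o = i , o

  mirrorInvariant⇒recurrent : MirrorInvariant r s z → Recurrent z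
  mirrorInvariant⇒recurrent mi w o = C∞-occur-beyond mi (length w) w ≤-refl (factor-CInfinity w o)

mainTheorem1 : (r s : ℕ) → r < s → (z : ℕ → ℕ) → SeqOverAlphabet r s z → Kolakoski z →
    ¬ EventuallyPeriodic z
    × (MirrorInvariant r s z → Recurrent z)
    × ((MirrorInvariant r s z → ∀ (w : List ℕ) → CInfinity r s w → Occurs z w)
    × ((∀ (w : List ℕ) → CInfinity r s w → Occurs z w) → MirrorInvariant r s z))
mainTheorem1 r s r<s z alph kol =
  Blocks.not-eventually-periodic z kol ,
  mirrorInvariant⇒recurrent ,
  (mirrorInvariant⇒CInfinity-occur , CInfinity-occur⇒mirrorInvariant)
  where open KolakoskiOver r s r<s z alph kol
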